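{- Let $T$ be a triangulation of $\mathbb{B}^2$ that is antipodally symmetric on the boundary, and let $L:V(T)\to\{+1,-1,\ldots,+n,-n\}$ be a labelling that, restricted to the boundary, is antipodal ($L(-v)=-L(v)$) and neighboring. Suppose $L$ has no complementary edges. Then there are at least $|\deg(L,\partial T)|$ triangles of $T$ whose labels are of the form $\{k_0,-k_1,k_2\}$, where $1\le|k_0|<|k_1|<|k_2|\le n$ and $k_0,k_1,k_2$ all have the same sign. In particular, there is at least one.
   Context: $T$ is antipodally symmetric on the boundary if the simplices of $T$ in $\mathbb{S}^1=\partial\mathbb{B}^2$ form an antipodally symmetric triangulation of $\mathbb{S}^1$. An edge is complementary if its endpoints have labels $a,-a$. The labels are in the cyclic order $1,2,\ldots,n,-1,-2,\ldots,-n$; two labels are neighbors if adjacent in this cyclic order. With boundary vertices $v_1,\ldots,v_m$ listed counterclockwise ($v_{m+1}=v_1$), $L$ is neighboring on the boundary if for each $k$ either $L(v_k)=L(v_{k+1})$ or they are neighbors, and $\deg(L,\partial T):=p-q$, where $p$ (resp. $q$) is the number of $k$ with $L(v_k)=1,L(v_{k+1})=2$ (resp. $L(v_k)=2,L(v_{k+1})=1$). -}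

module Defs where

open import Data.Nat as ℕ using (ℕ; zero; suc; _<ᵇ_; _≤ᵇ_)
open import Data.Integer as ℤ using (ℤ; +_; -_; _-_; ∣_∣)
open import Data.Fin using (Fin; toℕ)
open import Data.Fin.Properties as FinP using ()
open import Data.Integer.Properties as ℤP using ()
open import Data.Bool using (Bool; true; false; _∧_; _∨_)
open import Data.Product using (Σ; ∃; _×_; _,_)
open import Data.Sum using (_⊎_)
open import Data.List using (List; []; _∷_; length; filterᵇ; cartesianProduct; allFin; upTo; _++_; take)
open import Data.List.Membership.Propositional using (_∈_)
open import Data.List.Relation.Unary.Unique.Propositional using (Unique)
open import Data.List.Relation.Binary.Permutation.Propositional using (_↭_)
open import Relation.Nullary using (¬_; does)
open import Relation.Binary.PropositionalEquality using (_≡_)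
open import Relation.Binary.Construct.Closure.ReflexiveTransitive using (Star)
open import Function.Bundles using (_⇔_)

-- Vertices are Fin N.  A triangle is an ordered triple (x , y , z),
-- read as the oriented (counterclockwise) 2-simplex {x,y,z}.

Tri : ℕ → Set
Tri N = Fin N × Fin N × Fin N

_==ᶠ_ : ∀ {N} → Fin N → Fin N → Bool
a ==ᶠ b = does (a FinP.≟ b)

hasDirᵇ : ∀ {N} → Tri N → Fin N → Fin N → Bool
hasDirᵇ (x , y , z) a b =
  ((a ==ᶠ x) ∧ (b ==ᶠ y)) ∨ ((a ==ᶠ y) ∧ (b ==ᶠ z)) ∨ ((a ==ᶠ z) ∧ (b ==ᶠ x))

dcount : ∀ {N} → List (Tri N) → Fin N → Fin N → ℕ
dcount ts a b = length (filterᵇ (λ t → hasDirᵇ t a b) ts)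

RotIn : ∀ {N} → List (Tri N) → Tri N → Set
RotIn ts (x , y , z) = ((x , y , z) ∈ ts) ⊎ ((y , z , x) ∈ ts) ⊎ ((z , x , y) ∈ ts)

Adj : ∀ {N} → List (Tri N) → Fin N → Fin N → Set
Adj ts a b = 1 ℕ.≤ dcount ts a b ℕ.+ dcount ts b a

edgeCount : ∀ {N} → List (Tri N) → ℕ
edgeCount {N} ts = length (filterᵇ
  (λ p → let (a , b) = p in (toℕ a <ᵇ toℕ b) ∧ (1 ≤ᵇ (dcount ts a b ℕ.+ dcount ts b a)))
  (cartesianProduct (allFin N) (allFin N)))

data Consec {A : Set} : List A → A → A → Set where
  here  : ∀ {x y xs} → Consec (x ∷ y ∷ xs) x y
  there : ∀ {x xs a b} → Consec xs a b → Consec (x ∷ xs) a b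

CycConsec : {A : Set} → List A → A → A → Set
CycConsec ws b c = Consec (ws ++ take 1 ws) b c

-- The boundary circle is the cycle bd 0 , bd 1 , … , bd (2r-1)
-- (counterclockwise, indices taken modulo 2r), and the antipode of the
-- boundary vertex bd k is bd (k + r).
record SymDiskTriangulation (N : ℕ) : Set where
  field
    tris : List (Tri N)
    r    : ℕ
    bd   : ℕ → Fin N
    r≥2       : 2 ℕ.≤ r
    bd-period : ∀ k → bd (k ℕ.+ (r ℕ.+ r)) ≡ bd k
    bd-inj    : ∀ i j → i ℕ.< r ℕ.+ r → j ℕ.< r ℕ.+ r → bd i ≡ bd j → i ≡ j
    tri-distinct : ∀ x y z → (x , y , z) ∈ tris → ¬ x ≡ y × ¬ y ≡ z × ¬ z ≡ x
    covers : ∀ v → Σ (Fin N) λ b → Σ (Fin N) λ c → RotIn tris (v , b , c)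
    -- coherent orientation; boundary edges (bd k → bd (k+1)) lie in exactly
    -- one triangle, with the induced orientation; every other edge lies in
    -- zero or two triangles, with opposite induced orientations
    bd-edge   : ∀ k → dcount tris (bd k) (bd (suc k)) ≡ 1 × dcount tris (bd (suc k)) (bd k) ≡ 0
    int-edge  : ∀ a b → (∀ k → ¬ (bd k ≡ a × bd (suc k) ≡ b)) → (∀ k → ¬ (bd k ≡ b × bd (suc k) ≡ a)) →
                dcount tris a b ≡ dcount tris b a × dcount tris a b ℕ.≤ 1
    -- manifold condition: the link of a boundary vertex is a path, the link of
    -- an interior vertex is a cycle (of length ≥ 3)
    link-bd   : ∀ k → Σ (List (Fin N)) λ ws → Unique ws ×
                (∀ b c → RotIn tris (bd k , b , c) ⇔ Consec ws b c)
    link-int  : ∀ v → (∀ k → ¬ bd k ≡ v) → Σ (List (Fin N)) λ ws → Unique ws × 3 ℕ.≤ length ws ×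
                (∀ b c → RotIn tris (v , b , c) ⇔ CycConsec ws b c)
    connected : ∀ a b → Star (Adj tris) a b
    -- Euler characteristic 1:  V - E + F = 1
    euler     : N ℕ.+ length tris ≡ 1 ℕ.+ edgeCount tris

-- Labels  {+1,-1,…,+n,-n} ⊂ ℤ, in the cyclic order 1,2,…,n,-1,-2,…,-n

IsLabel : ℕ → ℤ → Set
IsLabel n x = 1 ℕ.≤ ∣ x ∣ × ∣ x ∣ ℕ.≤ n

data CycSucc (n : ℕ) : ℤ → ℤ → Set where
  pos   : ∀ k → 1 ℕ.≤ k → k ℕ.< n → CycSucc n (+ k) (+ suc k)
  neg   : ∀ k → 1 ℕ.≤ k → k ℕ.< n → CycSucc n (- (+ k)) (- (+ suc k))
  n→-1  : CycSucc n (+ n) (- (+ 1))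
  -n→1  : CycSucc n (- (+ n)) (+ 1)

Neighbors : ℕ → ℤ → ℤ → Set
Neighbors n x y = CycSucc n x y ⊎ CycSucc n y x

module _ {N : ℕ} (T : SymDiskTriangulation N) (n : ℕ) (L : Fin N → ℤ) where
  open SymDiskTriangulation T

  IsLabelling : Set
  IsLabelling = ∀ v → IsLabel n (L v)

  AntipodalOnBoundary : Set
  AntipodalOnBoundary = ∀ k → L (bd (k ℕ.+ r)) ≡ - L (bd k)

  NeighboringOnBoundary : Set
  NeighboringOnBoundary = ∀ k → L (bd k) ≡ L (bd (suc k)) ⊎ Neighbors n (L (bd k)) (L (bd (suc k)))

  NoComplementaryEdge : Set
  NoComplementaryEdge = ∀ a b → Adj tris a b → ¬ L a ≡ - L b

  _==ℤ_ : ℤ → ℤ → Bool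
  x ==ℤ y = does (x ℤP.≟ y)

  degP degQ : ℕ
  degP = length (filterᵇ (λ k → (L (bd k) ==ℤ (+ 1)) ∧ (L (bd (suc k)) ==ℤ (+ 2))) (upTo (r ℕ.+ r)))
  degQ = length (filterᵇ (λ k → (L (bd k) ==ℤ (+ 2)) ∧ (L (bd (suc k)) ==ℤ (+ 1))) (upTo (r ℕ.+ r)))

  deg : ℤ
  deg = + degP - + degQ

  AlternatingTri : Tri N → Set
  AlternatingTri (x , y , z) =
    Σ ℤ λ k0 → Σ ℤ λ k1 → Σ ℤ λ k2 →
      ((ℤ.+ 0 ℤ.< k0 × ℤ.+ 0 ℤ.< k1 × ℤ.+ 0 ℤ.< k2) ⊎ (k0 ℤ.< ℤ.+ 0 × k1 ℤ.< ℤ.+ 0 × k2 ℤ.< ℤ.+ 0)) ×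
      1 ℕ.≤ ∣ k0 ∣ × ∣ k0 ∣ ℕ.< ∣ k1 ∣ × ∣ k1 ∣ ℕ.< ∣ k2 ∣ × ∣ k2 ∣ ℕ.≤ n ×
      (L x ∷ L y ∷ L z ∷ []) ↭ (k0 ∷ - k1 ∷ k2 ∷ [])

module Submission where

-- Counting alternating triangles via a discrete Stokes theorem.
--
-- To every oriented edge of T we assign ω (L a) (L b), where ω is an
-- antisymmetric cochain on labels (a "crossing" cochain γ plus the coboundary
-- of the indicator of the label 1).  The proof has three ingredients:
--   * Stokes: for an antisymmetric cochain f, the sum of its coboundary ∂f
--     over all triangles equals the sum of f along the boundary cycle, since
--     interior edges occur in two oppositely oriented triangles.
--   * Local analysis: on a triangle without complementary edges the charge ∂ω
--     is 0, or it is ±1 and the labels are alternating {k0, -k1, k2}.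
--   * Boundary: along a neighboring boundary ω equals minus the degree
--     contribution of each step, and an antipodal labelling has odd degree
--     (a telescoping sum of the indicator ψ of the arc 2, …, n, −1 over half
--     of the boundary).
-- Hence |deg| = |total charge| is at most the number of charged triangles,
-- all of which are alternating, and |deg| ≥ 1.  The file develops integer sums,
-- cochains and directed edges of triangles, then Stokes, the label analysis,
-- the boundary analysis, and finally the corollary.

open import Defs
open import Data.Nat using (ℕ; _≤_)
open import Data.Integer using (ℤ; ∣_∣)
open import Data.Fin using (Fin)
open import Data.Product using (Σ; _×_)
open import Data.List using (List; length)
open import Data.List.Membership.Propositional using (_∈_)
open import Data.List.Relation.Unary.All using (All)
open import Data.List.Relation.Unary.Unique.Propositional using (Unique)

open import Data.Nat as ℕ using (zero; suc; s≤s; z≤n; _<_; _<ᵇ_)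
import Data.Nat.Properties as ℕP
open import Data.Nat.DivMod using (_%_; _/_; m≡m%n+[m/n]*n; m%n<n)
open import Data.Product using (∃; _,_; proj₁; proj₂)
open import Data.Sum using (_⊎_; inj₁; inj₂)
open import Data.Integer as ℤ using (+_; -[1+_]; -_; _+_; _-_; _*_; 0ℤ; 1ℤ)
import Data.Integer.Properties as ℤP
open import Data.Integer.Tactic.RingSolver using (solve-∀)
open import Data.Fin as Fin using (toℕ)
import Data.Fin.Properties as FinP
open import Data.Bool using (Bool; true; false; _∧_; _∨_; T)
import Data.Bool.Properties as BoolP
open import Data.List as List using ([]; _∷_; filter; filterᵇ; lookup; applyUpTo; upTo)
open import Data.List.Relation.Unary.Any using (here; there)
open import Data.List.Relation.Unary.All as All using (_∷_)
open import Data.List.Relation.Unary.AllPairs using ([]; _∷_)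
open import Data.List.Relation.Unary.Unique.Propositional.Properties using (filter⁺)
open import Data.List.Membership.Propositional.Properties using (∈-lookup; ∈-filter⁻)
open import Data.List.Relation.Binary.Permutation.Propositional using (_↭_; ↭-refl; ↭-trans; ↭-prep; ↭-swap)
open import Function using (_∘_; id)
open import Data.Empty using (⊥-elim)
open import Relation.Nullary using (¬_; ¬?; yes; no; Dec; does)
open import Relation.Unary using (Decidable)
open import Relation.Nullary.Decidable using (_×-dec_)
open import Relation.Binary.PropositionalEquality
open import Algebra.Properties.Semiring.Sum ℤP.+-*-semiring
  using (sum; sum-syntax; sum-cong-≗; sum-remove; sum-replicate-zero; ∑-distrib-+; ∑-comm; *-distribˡ-sum; *-distribʳ-sum)

ι : Bool → ℤ
ι true  = 1ℤ
ι false = 0ℤ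

∑-single : ∀ {n} (g : Fin n → ℤ) j → (∀ i → i ≢ j → g i ≡ 0ℤ) → sum g ≡ g j
∑-single {suc n} g j others = begin
  sum g                           ≡⟨ sum-remove {i = j} g ⟩
  g j + ∑[ k < n ] g (Fin.punchIn j k) ≡⟨ cong (_+_ (g j)) (sum-cong-≗ λ k → others _ (FinP.punchInᵢ≢i j k)) ⟩
  g j + ∑[ k < n ] 0ℤ             ≡⟨ cong (_+_ (g j)) (sum-replicate-zero n) ⟩
  g j + 0ℤ                        ≡⟨ ℤP.+-identityʳ (g j) ⟩
  g j                             ∎
  where open ≡-Reasoning

∑-neg : ∀ {n} (g : Fin n → ℤ) → ∑[ i < n ] (- g i) ≡ - sum g
∑-neg {zero}  g = refl
∑-neg {suc n} g = trans (cong (_+_ (- g Fin.zero)) (∑-neg (g ∘ Fin.suc))) (sym (ℤP.neg-distrib-+ (g Fin.zero) _))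

∑-sub : ∀ {n} (g h : Fin n → ℤ) → ∑[ i < n ] (g i - h i) ≡ sum g - sum h
∑-sub g h = trans (∑-distrib-+ g (λ i → - h i)) (cong (_+_ (sum g)) (∑-neg h))

∑-split : ∀ m n (g : ℕ → ℤ) →
  ∑[ i < m ℕ.+ n ] g (toℕ i) ≡ ∑[ i < m ] g (toℕ i) + ∑[ i < n ] g (m ℕ.+ toℕ i)
∑-split zero    n g = sym (ℤP.+-identityˡ _)
∑-split (suc m) n g = trans (cong (_+_ (g 0)) (∑-split m n (g ∘ suc))) (sym (ℤP.+-assoc (g 0) _ _))

∑-telescope : ∀ m (g : ℕ → ℤ) → ∑[ i < m ] (g (suc (toℕ i)) - g (toℕ i)) ≡ g m - g 0
∑-telescope zero    g = sym (ℤP.+-inverseʳ (g 0))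
∑-telescope (suc m) g = trans (cong (_+_ (g 1 - g 0)) (∑-telescope m (g ∘ suc))) (collapse (g 0) (g 1) (g (suc m)))
  where
  collapse : ∀ a b c → b - a + (c - b) ≡ c - a
  collapse = solve-∀

sumL : {A : Set} → List A → (A → ℤ) → ℤ
sumL xs g = ∑[ i < length xs ] g (lookup xs i)

sumL-cong : {A : Set} (xs : List A) {g h : A → ℤ} → (∀ t → t ∈ xs → g t ≡ h t) → sumL xs g ≡ sumL xs h
sumL-cong xs e = sum-cong-≗ λ i → e _ (∈-lookup i)

sumL-applyUpTo : ∀ (f : ℕ → ℕ) m (g : ℕ → ℤ) → sumL (applyUpTo f m) g ≡ ∑[ i < m ] g (f (toℕ i))
sumL-applyUpTo f zero    g = refl
sumL-applyUpTo f (suc m) g = cong (_+_ (g (f 0))) (sumL-applyUpTo (f ∘ suc) m g)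

count≡sumL : {A : Set} (p : A → Bool) (xs : List A) → + length (filterᵇ p xs) ≡ sumL xs (ι ∘ p)
count≡sumL p [] = refl
count≡sumL p (x ∷ xs) with p x
... | true  = cong (_+_ 1ℤ) (count≡sumL p xs)
... | false = trans (count≡sumL p xs) (sym (ℤP.+-identityˡ _))

nonzero? : {A : Set} (w : A → ℤ) → Decidable (λ t → ¬ w t ≡ 0ℤ)
nonzero? w t = ¬? (w t ℤP.≟ 0ℤ)

support-bound : {A : Set} (w : A → ℤ) (xs : List A) → (∀ t → t ∈ xs → ∣ w t ∣ ℕ.≤ 1) →
  ∣ sumL xs w ∣ ℕ.≤ length (filter (nonzero? w) xs)
support-bound w []       _     = z≤n
support-bound w (t ∷ ts) small with w t ℤP.≟ 0ℤ
... | yes wt≡0 =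
  subst (λ s → ∣ s ∣ ℕ.≤ length (filter (nonzero? w) ts))
        (sym (trans (cong (_+ sumL ts w) wt≡0) (ℤP.+-identityˡ (sumL ts w))))
        (support-bound w ts (λ u u∈ → small u (there u∈)))
... | no wt≢0 =
  ℕP.≤-trans (ℤP.∣i+j∣≤∣i∣+∣j∣ (w t) (sumL ts w))
             (ℕP.+-mono-≤ (small t (here refl)) (support-bound w ts (λ u u∈ → small u (there u∈))))

∑² : ∀ {n} → (Fin n → Fin n → ℤ) → ℤ
∑² {n} g = ∑[ a < n ] ∑[ b < n ] g a b

∑²-cong : ∀ {n} {g h : Fin n → Fin n → ℤ} → (∀ a b → g a b ≡ h a b) → ∑² g ≡ ∑² h
∑²-cong e = sum-cong-≗ λ a → sum-cong-≗ (e a)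

∑²-+ : ∀ {n} (g h : Fin n → Fin n → ℤ) → ∑² (λ a b → g a b + h a b) ≡ ∑² g + ∑² h
∑²-+ g h = trans (sum-cong-≗ λ a → ∑-distrib-+ (g a) (h a)) (∑-distrib-+ (λ a → sum (g a)) (λ a → sum (h a)))

Antisym : {A : Set} → (A → A → ℤ) → Set
Antisym f = ∀ a b → f a b ≡ - f b a

∂ : {A : Set} → (A → A → ℤ) → A → A → A → ℤ
∂ f a b c = f a b + (f b c + f c a)

∂-rot : {A : Set} (f : A → A → ℤ) → ∀ a b c → ∂ f b c a ≡ ∂ f a b c
∂-rot f a b c = rotate (f a b) (f b c) (f c a)
  where
  rotate : ∀ x y z → y + (z + x) ≡ x + (y + z)
  rotate = solve-∀

∂-swap : {A : Set} (f : A → A → ℤ) → Antisym f → ∀ a b c → ∂ f b a c ≡ - ∂ f a b c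
∂-swap f anti a b c = begin
  f b a + (f a c + f c b)           ≡⟨ cong₂ (λ u v → u + (v + f c b)) (anti b a) (anti a c) ⟩
  - f a b + (- f c a + f c b)       ≡⟨ cong (λ u → - f a b + (- f c a + u)) (anti c b) ⟩
  - f a b + (- f c a + - f b c)     ≡⟨ negate (f a b) (f b c) (f c a) ⟩
  - ∂ f a b c                       ∎
  where
  open ≡-Reasoning
  negate : ∀ x y z → - x + (- z + - y) ≡ - (x + (y + z))
  negate = solve-∀

self-negating : ∀ {s} → s ≡ - s → s ≡ 0ℤ
self-negating {+ zero}   _ = refl
self-negating {+ suc _}  ()
self-negating { -[1+ _ ]} ()

∂-degenerate : {A : Set} (f : A → A → ℤ) → Antisym f → ∀ a c → ∂ f a a c ≡ 0ℤ
∂-degenerate f anti a c = begin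
  f a a + (f a c + f c a)    ≡⟨ cong₂ (λ u v → u + (f a c + v)) (self-negating (anti a a)) (anti c a) ⟩
  0ℤ + (f a c + - f a c)     ≡⟨ cancel (f a c) ⟩
  0ℤ                         ∎
  where
  open ≡-Reasoning
  cancel : ∀ x → 0ℤ + (x + - x) ≡ 0ℤ
  cancel = solve-∀

∂-coboundary : {A : Set} (f : A → A → ℤ) (φ : A → ℤ) → ∀ a b c →
  ∂ (λ u v → f u v + (φ v - φ u)) a b c ≡ ∂ f a b c
∂-coboundary f φ a b c = cancel (f a b) (f b c) (f c a) (φ a) (φ b) (φ c)
  where
  cancel : ∀ x y z u v w → x + (v - u) + (y + (w - v) + (z + (u - w))) ≡ x + (y + z)
  cancel = solve-∀

∑-antisym : ∀ {n} (w f : Fin n → Fin n → ℤ) → (∀ a b → w a b ≡ w b a) → Antisym f →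
  ∑² (λ a b → w a b * f a b) ≡ 0ℤ
∑-antisym {n} w f sym-w anti-f = self-negating (begin
    S                                        ≡⟨ sum-cong-≗ (λ a → sum-cong-≗ λ b → flip a b) ⟩
    ∑[ a < n ] ∑[ b < n ] (- (w b a * f b a)) ≡⟨ sum-cong-≗ (λ a → ∑-neg λ b → w b a * f b a) ⟩
    ∑[ a < n ] (- ∑[ b < n ] (w b a * f b a)) ≡⟨ ∑-neg (λ a → ∑[ b < n ] (w b a * f b a)) ⟩
    - ∑[ a < n ] ∑[ b < n ] (w b a * f b a)   ≡⟨ cong -_ (∑-comm λ a b → w b a * f b a) ⟩
    - S                                      ∎)
  where
  open ≡-Reasoning
  S : ℤ
  S = ∑² (λ a b → w a b * f a b)
  flip : ∀ a b → w a b * f a b ≡ - (w b a * f b a)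
  flip a b = trans (cong₂ _*_ (sym-w a b) (anti-f a b)) (sym (ℤP.neg-distribʳ-* (w b a) (f b a)))

==ᶠ-refl : ∀ {N} (x : Fin N) → (x ==ᶠ x) ≡ true
==ᶠ-refl x with x FinP.≟ x
... | yes _  = refl
... | no x≢x = ⊥-elim (x≢x refl)

ι-∧ : ∀ p q → ι (p ∧ q) ≡ ι p * ι q
ι-∧ true  q     = sym (ℤP.*-identityˡ (ι q))
ι-∧ false q     = refl

ι-∨ : ∀ p q → p ∧ q ≡ false → ι (p ∨ q) ≡ ι p + ι q
ι-∨ true  true  ()
ι-∨ true  false _ = refl
ι-∨ false q     _ = sym (ℤP.+-identityˡ (ι q))

∑-delta : ∀ {N} (g : Fin N → ℤ) x → ∑[ a < N ] (ι (a ==ᶠ x) * g a) ≡ g x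
∑-delta g x = trans (∑-single _ x off-x) (trans (cong (λ p → ι p * g x) (==ᶠ-refl x)) (ℤP.*-identityˡ (g x)))
  where
  off-x : ∀ a → a ≢ x → ι (a ==ᶠ x) * g a ≡ 0ℤ
  off-x a a≢x with a FinP.≟ x
  ... | yes a≡x = ⊥-elim (a≢x a≡x)
  ... | no _    = refl

isEdge : ∀ {N} → Fin N → Fin N → Fin N → Fin N → Bool
isEdge u v a b = (a ==ᶠ u) ∧ (b ==ᶠ v)

∑²-edge : ∀ {N} (f : Fin N → Fin N → ℤ) u v → ∑² (λ a b → ι (isEdge u v a b) * f a b) ≡ f u v
∑²-edge {N} f u v = begin
  ∑² (λ a b → ι (isEdge u v a b) * f a b)
    ≡⟨ ∑²-cong (λ a b → trans (cong (_* f a b) (ι-∧ (a ==ᶠ u) (b ==ᶠ v))) (ℤP.*-assoc (ι (a ==ᶠ u)) _ _)) ⟩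
  ∑[ a < N ] ∑[ b < N ] (ι (a ==ᶠ u) * (ι (b ==ᶠ v) * f a b))
    ≡⟨ sum-cong-≗ (λ a → sym (*-distribˡ-sum (ι (a ==ᶠ u)) λ b → ι (b ==ᶠ v) * f a b)) ⟩
  ∑[ a < N ] (ι (a ==ᶠ u) * ∑[ b < N ] (ι (b ==ᶠ v) * f a b))
    ≡⟨ sum-cong-≗ (λ a → cong (ι (a ==ᶠ u) *_) (∑-delta (f a) v)) ⟩
  ∑[ a < N ] (ι (a ==ᶠ u) * f a v)
    ≡⟨ ∑-delta (λ a → f a v) u ⟩
  f u v ∎
  where open ≡-Reasoning

edges-exclusive : ∀ {N} {u u′ v v′ : Fin N} a b → ¬ u ≡ u′ → isEdge u v a b ∧ isEdge u′ v′ a b ≡ false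
edges-exclusive {u = u} {u′} {v} a b u≢u′ with a FinP.≟ u | a FinP.≟ u′
... | yes a≡u | yes a≡u′ = ⊥-elim (u≢u′ (trans (sym a≡u) a≡u′))
... | yes _   | no _     = BoolP.∧-zeroʳ (b ==ᶠ v)
... | no _    | _        = refl

ι-hasDir : ∀ {N} {x y z : Fin N} a b → ¬ x ≡ y → ¬ y ≡ z → ¬ z ≡ x →
  ι (hasDirᵇ (x , y , z) a b) ≡ ι (isEdge x y a b) + (ι (isEdge y z a b) + ι (isEdge z x a b))
ι-hasDir {x = x} {y} {z} a b x≢y y≢z z≢x = begin
  ι (A ∨ (B ∨ C))              ≡⟨ ι-∨ A (B ∨ C) A∧[B∨C] ⟩
  ι A + ι (B ∨ C)              ≡⟨ cong (_+_ (ι A)) (ι-∨ B C (edges-exclusive a b y≢z)) ⟩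
  ι A + (ι B + ι C)            ∎
  where
  open ≡-Reasoning
  A B C : Bool
  A = isEdge x y a b
  B = isEdge y z a b
  C = isEdge z x a b
  A∧[B∨C] : A ∧ (B ∨ C) ≡ false
  A∧[B∨C] = trans (BoolP.∧-distribˡ-∨ A B C)
                  (cong₂ _∨_ (edges-exclusive a b x≢y) (edges-exclusive a b (z≢x ∘ sym)))

∂-as-∑² : ∀ {N : ℕ} (f : Fin N → Fin N → ℤ) {x y z : Fin N} → ¬ x ≡ y → ¬ y ≡ z → ¬ z ≡ x →
  ∂ f x y z ≡ ∑² (λ a b → ι (hasDirᵇ (x , y , z) a b) * f a b)
∂-as-∑² {N} f {x} {y} {z} x≢y y≢z z≢x = sym (begin
  ∑² (λ a b → ι (hasDirᵇ (x , y , z) a b) * f a b)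
    ≡⟨ ∑²-cong (λ a b → trans (cong (_* f a b) (ι-hasDir a b x≢y y≢z z≢x))
                              (distrib (ι (isEdge x y a b)) (ι (isEdge y z a b)) (ι (isEdge z x a b)) (f a b))) ⟩
  ∑² (λ a b → E x y a b + (E y z a b + E z x a b))
    ≡⟨ trans (∑²-+ (E x y) _) (cong (_+_ (∑² (E x y))) (∑²-+ (E y z) (E z x))) ⟩
  ∑² (E x y) + (∑² (E y z) + ∑² (E z x))
    ≡⟨ cong₂ _+_ (∑²-edge f x y) (cong₂ _+_ (∑²-edge f y z) (∑²-edge f z x)) ⟩
  ∂ f x y z ∎)
  where
  open ≡-Reasoning
  E : Fin N → Fin N → Fin N → Fin N → ℤ
  E u v a b = ι (isEdge u v a b) * f a b
  distrib : ∀ p q r s → (p + (q + r)) * s ≡ p * s + (q * s + r * s)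
  distrib = solve-∀

∂△ : ∀ {N} → (Fin N → Fin N → ℤ) → Tri N → ℤ
∂△ f (x , y , z) = ∂ f x y z

hasDir-xy : ∀ {N} (x y z : Fin N) → hasDirᵇ (x , y , z) x y ≡ true
hasDir-xy x y z rewrite ==ᶠ-refl x | ==ᶠ-refl y = refl

hasDir-yz : ∀ {N} (x y z : Fin N) → hasDirᵇ (x , y , z) y z ≡ true
hasDir-yz x y z rewrite ==ᶠ-refl y | ==ᶠ-refl z = BoolP.∨-zeroʳ _

hasDir-zx : ∀ {N} (x y z : Fin N) → hasDirᵇ (x , y , z) z x ≡ true
hasDir-zx x y z rewrite ==ᶠ-refl z | ==ᶠ-refl x = trans (cong (((z ==ᶠ x) ∧ (x ==ᶠ y)) ∨_) (BoolP.∨-zeroʳ _)) (BoolP.∨-zeroʳ _)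

dcount-∈ : ∀ {N} {t : Tri N} {ts} a b → t ∈ ts → hasDirᵇ t a b ≡ true → 1 ℕ.≤ dcount ts a b
dcount-∈ {ts = u ∷ us} a b (here refl) has rewrite has = s≤s z≤n
dcount-∈ {ts = u ∷ us} a b (there t∈) has with hasDirᵇ u a b
... | true  = s≤s z≤n
... | false = dcount-∈ a b t∈ has

dcount-∷-hit : ∀ {N} (u : Tri N) us a b → hasDirᵇ u a b ≡ true → dcount (u ∷ us) a b ≡ suc (dcount us a b)
dcount-∷-hit u us a b has rewrite has = refl

dcount-∷ : ∀ {N} (u : Tri N) us a b → dcount us a b ℕ.≤ dcount (u ∷ us) a b
dcount-∷ u us a b with hasDirᵇ u a b
... | true  = ℕP.n≤1+n _
... | false = ℕP.≤-refl

unique-if-simple : ∀ {N} (ts : List (Tri N)) → (∀ a b → dcount ts a b ℕ.≤ 1) → Unique ts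
unique-if-simple []                   _      = []
unique-if-simple (u@(x , y , z) ∷ us) simple =
  All.tabulate not-again ∷ unique-if-simple us (λ a b → ℕP.≤-trans (dcount-∷ u us a b) (simple a b))
  where
  not-again : ∀ {v} → v ∈ us → ¬ u ≡ v
  not-again v∈ refl = ℕP.<-irrefl refl (ℕP.≤-trans twice (simple x y))
    where
    twice : 2 ℕ.≤ dcount (u ∷ us) x y
    twice = subst (2 ℕ.≤_) (sym (dcount-∷-hit u us x y (hasDir-xy x y z))) (s≤s (dcount-∈ x y v∈ (hasDir-xy x y z)))

-- the boundary cycle of a triangulated disk and the discrete Stokes theorem
module Boundary {N : ℕ} (T : SymDiskTriangulation N) where
  open SymDiskTriangulation T

  dc : Fin N → Fin N → ℕ
  dc = dcount tris

  M : ℕ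
  M = r ℕ.+ r

  instance
    M-nonZero : ℕ.NonZero M
    M-nonZero = ℕ.>-nonZero (ℕP.≤-trans (s≤s z≤n) (ℕP.≤-trans r≥2 (ℕP.m≤m+n r r)))

  β β⁺ : Fin M → Fin N
  β  k = bd (toℕ k)
  β⁺ k = bd (suc (toℕ k))

  bd-shift : ∀ j q → bd (j ℕ.+ q ℕ.* M) ≡ bd j
  bd-shift j zero    = cong bd (ℕP.+-identityʳ j)
  bd-shift j (suc q) = begin
    bd (j ℕ.+ (M ℕ.+ q ℕ.* M)) ≡⟨ cong bd (ℕP.+-comm j (M ℕ.+ q ℕ.* M)) ⟩
    bd ((M ℕ.+ q ℕ.* M) ℕ.+ j) ≡⟨ cong bd (ℕP.+-assoc M (q ℕ.* M) j) ⟩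
    bd (M ℕ.+ (q ℕ.* M ℕ.+ j)) ≡⟨ cong bd (ℕP.+-comm M _) ⟩
    bd (q ℕ.* M ℕ.+ j ℕ.+ M)   ≡⟨ bd-period (q ℕ.* M ℕ.+ j) ⟩
    bd (q ℕ.* M ℕ.+ j)         ≡⟨ cong bd (ℕP.+-comm (q ℕ.* M) j) ⟩
    bd (j ℕ.+ q ℕ.* M)         ≡⟨ bd-shift j q ⟩
    bd j                       ∎
    where open ≡-Reasoning

  position : ℕ → Fin M
  position k = Fin.fromℕ< (m%n<n k M)

  position-β : ∀ k → β (position k) ≡ bd k × β⁺ (position k) ≡ bd (suc k)
  position-β k =
      trans (cong bd (FinP.toℕ-fromℕ< (m%n<n k M)))
            (trans (sym (bd-shift (k % M) (k / M))) (cong bd (sym (m≡m%n+[m/n]*n k M))))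
    , trans (cong (bd ∘ suc) (FinP.toℕ-fromℕ< (m%n<n k M)))
            (trans (sym (bd-shift (suc (k % M)) (k / M))) (cong (bd ∘ suc) (sym (m≡m%n+[m/n]*n k M))))

  BdEdge : Fin N → Fin N → Set
  BdEdge a b = ∃ λ k → β k ≡ a × β⁺ k ≡ b

  bdEdge? : ∀ a b → Dec (BdEdge a b)
  bdEdge? a b = FinP.any? λ k → (β k FinP.≟ a) ×-dec (β⁺ k FinP.≟ b)

  not-bdEdge : ∀ {a b} → ¬ BdEdge a b → ∀ k → ¬ (bd k ≡ a × bd (suc k) ≡ b)
  not-bdEdge ¬e k (p , q) = ¬e (position k , trans (proj₁ (position-β k)) p , trans (proj₂ (position-β k)) q)

  bdEdge-count : ∀ {a b} → BdEdge a b → dc a b ≡ 1 × dc b a ≡ 0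
  bdEdge-count (k , refl , refl) = bd-edge (toℕ k)

  bdEdge-oriented : ∀ {a b} → BdEdge a b → ¬ BdEdge b a
  bdEdge-oriented e e′ with trans (sym (proj₂ (bdEdge-count e))) (proj₁ (bdEdge-count e′))
  ... | ()

  edge-cases : ∀ a b → BdEdge a b ⊎ BdEdge b a ⊎ (¬ BdEdge a b × ¬ BdEdge b a)
  edge-cases a b with bdEdge? a b | bdEdge? b a
  ... | yes e  | _      = inj₁ e
  ... | no _   | yes e′ = inj₂ (inj₁ e′)
  ... | no ¬e  | no ¬e′ = inj₂ (inj₂ (¬e , ¬e′))

  interior-count : ∀ {a b} → ¬ BdEdge a b → ¬ BdEdge b a → dc a b ≡ dc b a × dc a b ℕ.≤ 1
  interior-count ¬e ¬e′ = int-edge _ _ (not-bdEdge ¬e) (not-bdEdge ¬e′)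

  dc≤1 : ∀ a b → dc a b ℕ.≤ 1
  dc≤1 a b with edge-cases a b
  ... | inj₁ e              = ℕP.≤-reflexive (proj₁ (bdEdge-count e))
  ... | inj₂ (inj₁ e′)      = ℕP.≤-trans (ℕP.≤-reflexive (proj₂ (bdEdge-count e′))) z≤n
  ... | inj₂ (inj₂ (¬e , ¬e′)) = proj₂ (interior-count ¬e ¬e′)

  bdCount : Fin N → Fin N → ℤ
  bdCount a b = ∑[ k < M ] ι (isEdge (β k) (β⁺ k) a b)

  -- by injectivity of bd, a boundary edge sits at exactly one position
  bdCount-edge : ∀ k → bdCount (β k) (β⁺ k) ≡ 1ℤ
  bdCount-edge k = trans (∑-single _ k elsewhere)
                         (cong₂ (λ p q → ι (p ∧ q)) (==ᶠ-refl (β k)) (==ᶠ-refl (β⁺ k)))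
    where
    elsewhere : ∀ i → i ≢ k → ι (isEdge (β i) (β⁺ i) (β k) (β⁺ k)) ≡ 0ℤ
    elsewhere i i≢k with β k FinP.≟ β i
    ... | no _    = refl
    ... | yes βk≡βi = ⊥-elim (i≢k (FinP.toℕ-injective
          (bd-inj (toℕ i) (toℕ k) (FinP.toℕ<n i) (FinP.toℕ<n k) (sym βk≡βi))))

  bdCount-none : ∀ {a b} → ¬ BdEdge a b → bdCount a b ≡ 0ℤ
  bdCount-none {a} {b} ¬e = trans (sum-cong-≗ absent) (sum-replicate-zero M)
    where
    absent : ∀ k → ι (isEdge (β k) (β⁺ k) a b) ≡ 0ℤ
    absent k with a FinP.≟ β k | b FinP.≟ β⁺ k
    ... | yes p | yes q = ⊥-elim (¬e (k , sym p , sym q))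
    ... | yes _ | no _  = refl
    ... | no _  | _     = refl

  interior : Fin N → Fin N → ℤ
  interior a b = + dc a b - bdCount a b

  interior-bdEdge : ∀ {a b} → BdEdge a b → interior a b ≡ 0ℤ × interior b a ≡ 0ℤ
  interior-bdEdge e@(k , refl , refl) =
      cong₂ (λ u v → + u - v) (proj₁ (bdEdge-count e)) (bdCount-edge k)
    , cong₂ (λ u v → + u - v) (proj₂ (bdEdge-count e)) (bdCount-none (bdEdge-oriented e))

  -- interior edges are shared by two oppositely oriented triangles, so the
  -- interior multiplicity is symmetric
  interior-sym : ∀ a b → interior a b ≡ interior b a
  interior-sym a b with edge-cases a b
  ... | inj₁ e         = let (ab , ba) = interior-bdEdge e in trans ab (sym ba)
  ... | inj₂ (inj₁ e′) = let (ba , ab) = interior-bdEdge e′ in trans ab (sym ba)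
  ... | inj₂ (inj₂ (¬e , ¬e′)) =
    cong₂ (λ u v → + u - v) (proj₁ (interior-count ¬e ¬e′)) (trans (bdCount-none ¬e) (sym (bdCount-none ¬e′)))

  triangles-to-edges : (f : Fin N → Fin N → ℤ) → sumL tris (∂△ f) ≡ ∑² (λ a b → + dc a b * f a b)
  triangles-to-edges f = begin
    sumL tris (∂△ f)
      ≡⟨ sumL-cong tris expand ⟩
    sumL tris (λ t → ∑² (λ a b → ι (hasDirᵇ t a b) * f a b))
      ≡⟨ trans (∑-comm λ i a → ∑[ b < N ] (h i a b)) (sum-cong-≗ λ a → ∑-comm λ i b → h i a b) ⟩
    ∑² (λ a b → sumL tris (λ t → ι (hasDirᵇ t a b) * f a b))
      ≡⟨ ∑²-cong (λ a b → trans (sym (*-distribʳ-sum {length tris} (f a b) λ i → ι (hasDirᵇ (lookup tris i) a b)))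
                                (cong (_* f a b) (sym (count≡sumL (λ t → hasDirᵇ t a b) tris)))) ⟩
    ∑² (λ a b → + dc a b * f a b) ∎
    where
    open ≡-Reasoning
    h : Fin (length tris) → Fin N → Fin N → ℤ
    h i a b = ι (hasDirᵇ (lookup tris i) a b) * f a b
    expand : ∀ t → t ∈ tris → ∂△ f t ≡ ∑² (λ a b → ι (hasDirᵇ t a b) * f a b)
    expand (x , y , z) t∈ = let (x≢y , y≢z , z≢x) = tri-distinct x y z t∈ in ∂-as-∑² f x≢y y≢z z≢x

  boundary-edges : (f : Fin N → Fin N → ℤ) → ∑² (λ a b → bdCount a b * f a b) ≡ ∑[ k < M ] f (β k) (β⁺ k)
  boundary-edges f = begin
    ∑² (λ a b → bdCount a b * f a b)
      ≡⟨ ∑²-cong (λ a b → *-distribʳ-sum (f a b) λ k → ι (isEdge (β k) (β⁺ k) a b)) ⟩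
    ∑² (λ a b → ∑[ k < M ] h k a b)
      ≡⟨ trans (sum-cong-≗ λ a → ∑-comm λ b k → h k a b) (∑-comm λ a k → ∑[ b < N ] h k a b) ⟩
    ∑[ k < M ] ∑² (h k)
      ≡⟨ sum-cong-≗ (λ k → ∑²-edge f (β k) (β⁺ k)) ⟩
    ∑[ k < M ] f (β k) (β⁺ k) ∎
    where
    open ≡-Reasoning
    h : Fin M → Fin N → Fin N → ℤ
    h k a b = ι (isEdge (β k) (β⁺ k) a b) * f a b

  stokes : (f : Fin N → Fin N → ℤ) → Antisym f → sumL tris (∂△ f) ≡ ∑[ k < M ] f (β k) (β⁺ k)
  stokes f anti = begin
    sumL tris (∂△ f)
      ≡⟨ triangles-to-edges f ⟩
    ∑² (λ a b → + dc a b * f a b)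
      ≡⟨ ∑²-cong (λ a b → split (+ dc a b) (bdCount a b) (f a b)) ⟩
    ∑² (λ a b → interior a b * f a b + bdCount a b * f a b)
      ≡⟨ ∑²-+ (λ a b → interior a b * f a b) (λ a b → bdCount a b * f a b) ⟩
    ∑² (λ a b → interior a b * f a b) + ∑² (λ a b → bdCount a b * f a b)
      ≡⟨ cong₂ _+_ (∑-antisym interior f interior-sym anti) (boundary-edges f) ⟩
    0ℤ + ∑[ k < M ] f (β k) (β⁺ k)
      ≡⟨ ℤP.+-identityˡ _ ⟩
    ∑[ k < M ] f (β k) (β⁺ k) ∎
    where
    open ≡-Reasoning
    split : ∀ p q c → p * c ≡ (p - q) * c + q * c
    split = solve-∀

below : ℕ → ℕ → ℤ
below a b = ι (a <ᵇ b)

below-yes : ∀ {a b} → a < b → below a b ≡ 1ℤ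
below-yes {a} {b} a<b with a <ᵇ b | ℕP.<⇒<ᵇ a<b
... | true | _ = refl

below-no : ∀ {a b} → b ℕ.≤ a → below a b ≡ 0ℤ
below-no {a} {b} b≤a with a <ᵇ b in eq
... | false = refl
... | true  = ⊥-elim (ℕP.<⇒≱ (ℕP.<ᵇ⇒< a b (subst T (sym eq) _)) b≤a)

-- the crossing cochain on labels: an edge from a positive label to a larger
-- negative one counts +1, an edge from a negative label to a smaller positive one −1
γ : ℤ → ℤ → ℤ
γ (+ a)    (+ b)    = 0ℤ
γ (+ a)    -[1+ b ] = below a (suc b)
γ -[1+ a ] (+ b)    = - below b (suc a)
γ -[1+ a ] -[1+ b ] = 0ℤ

γ-antisym : Antisym γ
γ-antisym (+ a)    (+ b)    = refl
γ-antisym (+ a)    -[1+ b ] = sym (ℤP.neg-involutive _)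
γ-antisym -[1+ a ] (+ b)    = refl
γ-antisym -[1+ a ] -[1+ b ] = refl

φ : ℤ → ℤ
φ (+ 1) = 1ℤ
φ _     = 0ℤ

-- the cochain used for counting: γ corrected by the coboundary of φ, so that
-- along the boundary it only sees the steps between 1 and 2
ω : ℤ → ℤ → ℤ
ω x y = γ x y + (φ y - φ x)

ω-antisym : Antisym ω
ω-antisym x y = trans (cong (_+ (φ y - φ x)) (γ-antisym x y)) (negate (γ y x) (φ x) (φ y))
  where
  negate : ∀ g u v → - g + (v - u) ≡ - (g + (u - v))
  negate = solve-∀

Alternating : ℕ → ℤ → ℤ → ℤ → Set
Alternating n a b c =
  Σ ℤ λ k0 → Σ ℤ λ k1 → Σ ℤ λ k2 →
    ((ℤ.+ 0 ℤ.< k0 × ℤ.+ 0 ℤ.< k1 × ℤ.+ 0 ℤ.< k2) ⊎ (k0 ℤ.< ℤ.+ 0 × k1 ℤ.< ℤ.+ 0 × k2 ℤ.< ℤ.+ 0)) ×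
    1 ℕ.≤ ∣ k0 ∣ × ∣ k0 ∣ ℕ.< ∣ k1 ∣ × ∣ k1 ∣ ℕ.< ∣ k2 ∣ × ∣ k2 ∣ ℕ.≤ n ×
    (a ∷ b ∷ c ∷ []) ↭ (k0 ∷ - k1 ∷ k2 ∷ [])

NonCompl : ℤ → ℤ → Set
NonCompl x y = ¬ x ≡ - y × ¬ y ≡ - x

Admissible : ℕ → ℤ → ℤ → ℤ → Set
Admissible n a b c = IsLabel n a × IsLabel n b × IsLabel n c × NonCompl a b × NonCompl b c × NonCompl c a

Charged : ℕ → ℤ → ℤ → ℤ → Set
Charged n a b c = ∂ γ a b c ≡ 0ℤ ⊎ (∣ ∂ γ a b c ∣ ≡ 1 × Alternating n a b c)

equal-magnitude : ∀ x y → ∣ x ∣ ≡ ∣ y ∣ → ¬ x ≡ - y → x ≡ y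
equal-magnitude (+ a)    (+ b)    e _   = cong +_ e
equal-magnitude (+ a)    -[1+ b ] e x≢ = ⊥-elim (x≢ (cong +_ e))
equal-magnitude -[1+ a ] (+ b)    e x≢ = ⊥-elim (x≢ (cong (-_ ∘ +_) e))
equal-magnitude -[1+ a ] -[1+ b ] e _   = cong -[1+_] (ℕP.suc-injective e)

charged-strict : ∀ n a b c → IsLabel n a → IsLabel n c → ∣ a ∣ < ∣ b ∣ → ∣ b ∣ < ∣ c ∣ → Charged n a b c
charged-strict n (+ A) (+ B) (+ C) _ _ ab bc = inj₁ refl
charged-strict n (+ A) (+ B) -[1+ C ] _ _ ab bc
  rewrite below-yes bc | below-yes (ℕP.<-trans ab bc) = inj₁ refl
charged-strict n (+ A) -[1+ B ] (+ C) (1≤A , _) (1≤C , C≤n) ab bc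
  rewrite below-yes ab | below-no (ℕP.<⇒≤ bc) =
    inj₂ (refl , + A , + suc B , + C , inj₁ (ℤ.+<+ 1≤A , ℤ.+<+ (s≤s z≤n) , ℤ.+<+ 1≤C) , 1≤A , ab , bc , C≤n , ↭-refl)
charged-strict n (+ A) -[1+ B ] -[1+ C ] _ _ ab bc
  rewrite below-yes ab | below-yes (ℕP.<-trans ab bc) = inj₁ refl
charged-strict n -[1+ A ] (+ B) (+ C) _ _ ab bc
  rewrite below-no (ℕP.<⇒≤ ab) | below-no (ℕP.<⇒≤ (ℕP.<-trans ab bc)) = inj₁ refl
charged-strict n -[1+ A ] (+ suc B) -[1+ C ] _ (_ , C≤n) ab bc
  rewrite below-no (ℕP.<⇒≤ ab) | below-yes bc =
    inj₂ (refl , -[1+ A ] , -[1+ B ] , -[1+ C ] , inj₂ (ℤ.-<+ , ℤ.-<+ , ℤ.-<+) , s≤s z≤n , ab , bc , C≤n , ↭-refl)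
charged-strict n -[1+ A ] -[1+ B ] (+ C) _ _ ab bc
  rewrite below-no (ℕP.<⇒≤ bc) | below-no (ℕP.<⇒≤ (ℕP.<-trans ab bc)) = inj₁ refl
charged-strict n -[1+ A ] -[1+ B ] -[1+ C ] _ _ ab bc = inj₁ refl

-- labels of weakly increasing magnitude: equal magnitudes force a degenerate triangle
charged-sorted : ∀ n a b c → Admissible n a b c → ∣ a ∣ ℕ.≤ ∣ b ∣ → ∣ b ∣ ℕ.≤ ∣ c ∣ → Charged n a b c
charged-sorted n a b c (La , _ , Lc , (a≢-b , _) , (b≢-c , _) , _) ab bc
  with ℕP.m≤n⇒m<n∨m≡n ab | ℕP.m≤n⇒m<n∨m≡n bc
... | inj₂ |a|≡|b| | _ with equal-magnitude a b |a|≡|b| a≢-b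
...   | refl = inj₁ (∂-degenerate γ γ-antisym a c)
charged-sorted n a b c (La , _ , Lc , (a≢-b , _) , (b≢-c , _) , _) ab bc
    | inj₁ _ | inj₂ |b|≡|c| with equal-magnitude b c |b|≡|c| b≢-c
...   | refl = inj₁ (trans (sym (∂-rot γ a b b)) (∂-degenerate γ γ-antisym b a))
charged-sorted n a b c (La , _ , Lc , _) ab bc | inj₁ a<b | inj₁ b<c = charged-strict n a b c La Lc a<b b<c

sort3 : {A : Set} (m : A → ℕ) (Q : A → A → A → Set) →
  (∀ {a b c} → Q a b c → Q b c a) → (∀ {a b c} → Q a b c → Q b a c) →
  (∀ a b c → m a ℕ.≤ m b → m b ℕ.≤ m c → Q a b c) → ∀ a b c → Q a b c
sort3 m Q rot swap sorted a b c with ℕP.≤-total (m a) (m b) | ℕP.≤-total (m b) (m c) | ℕP.≤-total (m a) (m c)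
... | inj₁ ab | inj₁ bc | _      = sorted a b c ab bc
... | inj₁ ab | inj₂ cb | inj₁ ac = rot (swap (sorted a c b ac cb))
... | inj₁ ab | inj₂ cb | inj₂ ca = rot (sorted c a b ca ab)
... | inj₂ ba | _      | inj₁ ac = swap (sorted b a c ba ac)
... | inj₂ ba | inj₁ bc | inj₂ ca = rot (rot (sorted b c a bc ca))
... | inj₂ ba | inj₂ cb | inj₂ ca = rot (rot (swap (sorted c b a cb ba)))

alternating-perm : ∀ {n a b c a′ b′ c′} → (a ∷ b ∷ c ∷ []) ↭ (a′ ∷ b′ ∷ c′ ∷ []) →
  Alternating n a′ b′ c′ → Alternating n a b c
alternating-perm π (k0 , k1 , k2 , signs , 1≤k0 , k0<k1 , k1<k2 , k2≤n , p) =
  k0 , k1 , k2 , signs , 1≤k0 , k0<k1 , k1<k2 , k2≤n , ↭-trans π p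

charged-rot : ∀ {n a b c} → Charged n a b c → Charged n b c a
charged-rot {a = a} {b} {c} (inj₁ q≡0)       = inj₁ (trans (∂-rot γ a b c) q≡0)
charged-rot {a = a} {b} {c} (inj₂ (∣q∣≡1 , alt)) =
  inj₂ (trans (cong ∣_∣ (∂-rot γ a b c)) ∣q∣≡1 , alternating-perm (↭-trans (↭-prep b (↭-swap c a ↭-refl)) (↭-swap b a ↭-refl)) alt)

charged-swap : ∀ {n a b c} → Charged n a b c → Charged n b a c
charged-swap {a = a} {b} {c} (inj₁ q≡0)       = inj₁ (trans (∂-swap γ γ-antisym a b c) (cong -_ q≡0))
charged-swap {a = a} {b} {c} (inj₂ (∣q∣≡1 , alt)) =
  inj₂ (trans (cong ∣_∣ (∂-swap γ γ-antisym a b c)) (trans (ℤP.∣-i∣≡∣i∣ (∂ γ a b c)) ∣q∣≡1) , alternating-perm (↭-swap b a ↭-refl) alt)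

admissible-unrot : ∀ {n a b c} → Admissible n b c a → Admissible n a b c
admissible-unrot (Lb , Lc , La , bc , ca , ab) = La , Lb , Lc , ab , bc , ca

admissible-unswap : ∀ {n a b c} → Admissible n b a c → Admissible n a b c
admissible-unswap (Lb , La , Lc , (b≢-a , a≢-b) , (a≢-c , c≢-a) , (c≢-b , b≢-c)) =
  La , Lb , Lc , (a≢-b , b≢-a) , (b≢-c , c≢-b) , (c≢-a , a≢-c)

charged : ∀ n a b c → Admissible n a b c → Charged n a b c
charged n = sort3 ∣_∣ (λ a b c → Admissible n a b c → Charged n a b c)
                  (λ q adm → charged-rot (q (admissible-unrot adm)))
                  (λ q adm → charged-swap (q (admissible-unswap adm)))
                  (λ a b c ab bc adm → charged-sorted n a b c adm ab bc)

up₁₂ down₂₁ : ℤ → ℤ → Bool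
up₁₂   x y = does (x ℤP.≟ + 1) ∧ does (y ℤP.≟ + 2)
down₂₁ x y = does (x ℤP.≟ + 2) ∧ does (y ℤP.≟ + 1)

δ : ℤ → ℤ → ℤ
δ x y = ι (up₁₂ x y) - ι (down₂₁ x y)

δ-self : ∀ x → δ x x ≡ 0ℤ
δ-self x = trans (cong (λ p → ι (up₁₂ x x) - ι p) (BoolP.∧-comm (does (x ℤP.≟ + 2)) (does (x ℤP.≟ + 1))))
                 (ℤP.+-inverseʳ (ι (up₁₂ x x)))

-- indicator of the arc 2, 3, …, n, −1 of the cyclic order of labels; it is
-- entered or left exactly through the steps between 1 and 2 or between −1 and −2
ψ : ℤ → ℤ
ψ (+ suc (suc _)) = 1ℤ
ψ -[1+ 0 ]        = 1ℤ
ψ _               = 0ℤ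

ψ-antipodal : ∀ {n} x → IsLabel n x → ψ x + ψ (- x) ≡ 1ℤ
ψ-antipodal (+ 1)             _ = refl
ψ-antipodal (+ suc (suc _))   _ = refl
ψ-antipodal -[1+ 0 ]          _ = refl
ψ-antipodal -[1+ suc _ ]      _ = refl

BoundaryStep : ℤ → ℤ → Set
BoundaryStep x y = ω x y ≡ - δ x y × ψ y - ψ x ≡ δ x y - δ (- x) (- y)

step-stay : ∀ x → BoundaryStep x x
step-stay x = trans ω-self (sym (cong -_ (δ-self x)))
            , trans (ℤP.+-inverseʳ (ψ x)) (sym (cong₂ _-_ (δ-self x) (δ-self (- x))))
  where
  ω-self : ω x x ≡ 0ℤ
  ω-self = cong₂ _+_ (self-negating (γ-antisym x x)) (ℤP.+-inverseʳ (φ x))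

-- a step between successive labels, in either direction: direct computation in
-- each case; the steps n → −1 and −n → 1 are complementary when n = 1
step-succ : ∀ {n x y} → IsLabel n x → NonCompl x y → CycSucc n x y → BoundaryStep x y × BoundaryStep y x
step-succ _ _ (pos 1 _ _)                 = (refl , refl) , (refl , refl)
step-succ _ _ (pos 2 _ _)                 = (refl , refl) , (refl , refl)
step-succ _ _ (pos (suc (suc (suc _))) _ _) = (refl , refl) , (refl , refl)
step-succ _ _ (neg 1 _ _)                 = (refl , refl) , (refl , refl)
step-succ _ _ (neg 2 _ _)                 = (refl , refl) , (refl , refl)
step-succ _ _ (neg (suc (suc (suc _))) _ _) = (refl , refl) , (refl , refl)
step-succ {n = 1} _ (x≢-y , _) n→-1       = ⊥-elim (x≢-y refl)
step-succ {n = 2} _ _ n→-1                = (refl , refl) , (refl , refl)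
step-succ {n = suc (suc (suc _))} _ _ n→-1 = (refl , refl) , (refl , refl)
step-succ {n = 1} _ (x≢-y , _) -n→1       = ⊥-elim (x≢-y refl)
step-succ {n = 2} _ _ -n→1                = (refl , refl) , (refl , refl)
step-succ {n = suc (suc (suc _))} _ _ -n→1 = (refl , refl) , (refl , refl)

step : ∀ {n x y} → IsLabel n x → IsLabel n y → NonCompl x y → x ≡ y ⊎ Neighbors n x y → BoundaryStep x y
step {x = x} _ _ _       (inj₁ refl)         = step-stay x
step Lx _  nc         (inj₂ (inj₁ x→y))   = proj₁ (step-succ Lx nc x→y)
step _  Ly (p , q)    (inj₂ (inj₂ y→x))   = proj₂ (step-succ Ly (q , p) y→x)

odd≢0 : ∀ w → ¬ 1ℤ + (w + w) ≡ 0ℤ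
odd≢0 (+ _)     ()
odd≢0 -[1+ _ ]  ()

module Corollary {N : ℕ} (T : SymDiskTriangulation N) (n : ℕ) (L : Fin N → ℤ)
  (labelling : IsLabelling T n L) (antipodal : AntipodalOnBoundary T n L)
  (neighboring : NeighboringOnBoundary T n L) (no-compl : NoComplementaryEdge T n L) where
  open SymDiskTriangulation T
  open Boundary T

  edge-noncompl : ∀ {a b} → 1 ℕ.≤ dc a b → NonCompl (L a) (L b)
  edge-noncompl {a} {b} 1≤ab =
      no-compl a b (ℕP.≤-trans 1≤ab (ℕP.m≤m+n (dc a b) (dc b a)))
    , no-compl b a (ℕP.≤-trans 1≤ab (ℕP.m≤n+m (dc a b) (dc b a)))

  lab : ℕ → ℤ
  lab k = L (bd k)

  d : ℕ → ℤ
  d k = δ (lab k) (lab (suc k))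

  boundary-step : ∀ k → BoundaryStep (lab k) (lab (suc k))
  boundary-step k = step (labelling _) (labelling _)
                         (edge-noncompl (ℕP.≤-reflexive (sym (proj₁ (bd-edge k))))) (neighboring k)

  deg-as-sum : deg T n L ≡ ∑[ k < M ] d (toℕ k)
  deg-as-sum = trans (cong₂ _-_ (count-steps up₁₂) (count-steps down₂₁))
                     (sym (∑-sub {M} (indicator up₁₂ ∘ toℕ) (indicator down₂₁ ∘ toℕ)))
    where
    indicator : (ℤ → ℤ → Bool) → ℕ → ℤ
    indicator p k = ι (p (lab k) (lab (suc k)))
    count-steps : (p : ℤ → ℤ → Bool) → + length (filterᵇ (λ k → p (lab k) (lab (suc k))) (upTo M))
                        ≡ ∑[ k < M ] indicator p (toℕ k)
    count-steps p = trans (count≡sumL _ (upTo M)) (sumL-applyUpTo id M (indicator p))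

  F : Fin N → Fin N → ℤ
  F a b = ω (L a) (L b)

  charge : Tri N → ℤ
  charge = ∂△ F

  total-charge : sumL tris charge ≡ - deg T n L
  total-charge = begin
    sumL tris charge                  ≡⟨ stokes F (λ a b → ω-antisym (L a) (L b)) ⟩
    ∑[ k < M ] F (β k) (β⁺ k)          ≡⟨ sum-cong-≗ {M} (λ k → proj₁ (boundary-step (toℕ k))) ⟩
    ∑[ k < M ] (- d (toℕ k))           ≡⟨ ∑-neg {M} (d ∘ toℕ) ⟩
    - ∑[ k < M ] d (toℕ k)             ≡⟨ cong -_ (sym deg-as-sum) ⟩
    - deg T n L                       ∎
    where open ≡-Reasoning

  triangle-charged : ∀ {t} → t ∈ tris → charge t ≡ 0ℤ ⊎ (∣ charge t ∣ ≡ 1 × AlternatingTri T n L t)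
  triangle-charged {u , v , w} t∈ rewrite ∂-coboundary γ φ (L u) (L v) (L w) =
    charged n (L u) (L v) (L w)
      ( labelling u , labelling v , labelling w
      , edge-noncompl (dcount-∈ u v t∈ (hasDir-xy u v w))
      , edge-noncompl (dcount-∈ v w t∈ (hasDir-yz u v w))
      , edge-noncompl (dcount-∈ w u t∈ (hasDir-zx u v w)))

  antipode : ∀ k → lab (r ℕ.+ k) ≡ - lab k
  antipode k = trans (cong lab (ℕP.+-comm r k)) (antipodal k)

  antipodal-step : ∀ k → d (r ℕ.+ k) ≡ δ (- lab k) (- lab (suc k))
  antipodal-step k = cong₂ δ (antipode k) (trans (cong lab (sym (ℕP.+-suc r k))) (antipode (suc k)))

  -- a step and its antipode contribute the change of ψ; over half the boundary
  -- ψ changes from ψ (lab 0) to ψ (−lab 0) = 1 − ψ (lab 0)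
  half-difference : ∑[ k < r ] d (toℕ k) - ∑[ k < r ] d (r ℕ.+ toℕ k) ≡ 1ℤ - ψ (lab 0) - ψ (lab 0)
  half-difference = begin
    ∑[ k < r ] d (toℕ k) - ∑[ k < r ] d (r ℕ.+ toℕ k)
      ≡⟨ sym (∑-sub {r} (d ∘ toℕ) (λ k → d (r ℕ.+ toℕ k))) ⟩
    ∑[ k < r ] (d (toℕ k) - d (r ℕ.+ toℕ k))
      ≡⟨ sum-cong-≗ {r} (λ k → trans (cong (_-_ (d (toℕ k))) (antipodal-step (toℕ k)))
                                     (sym (proj₂ (boundary-step (toℕ k))))) ⟩
    ∑[ k < r ] (ψ (lab (suc (toℕ k))) - ψ (lab (toℕ k)))
      ≡⟨ ∑-telescope r (ψ ∘ lab) ⟩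
    ψ (lab r) - ψ (lab 0)
      ≡⟨ cong (λ y → ψ y - ψ (lab 0)) (antipodal 0) ⟩
    ψ (- lab 0) - ψ (lab 0)
      ≡⟨ regroup (ψ (lab 0)) (ψ (- lab 0)) ⟩
    ψ (lab 0) + ψ (- lab 0) - ψ (lab 0) - ψ (lab 0)
      ≡⟨ cong (λ s → s - ψ (lab 0) - ψ (lab 0)) (ψ-antipodal (lab 0) (labelling (bd 0))) ⟩
    1ℤ - ψ (lab 0) - ψ (lab 0) ∎
    where
    open ≡-Reasoning
    regroup : ∀ p q → q - p ≡ p + q - p - p
    regroup = solve-∀

  deg-odd : Σ ℤ λ w → deg T n L ≡ 1ℤ + (w + w)
  deg-odd = B - p , (begin
    deg T n L                  ≡⟨ deg-as-sum ⟩
    ∑[ k < M ] d (toℕ k)        ≡⟨ ∑-split r r d ⟩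
    A + B                      ≡⟨ halves A B ⟩
    (A - B) + (B + B)          ≡⟨ cong (_+ (B + B)) half-difference ⟩
    1ℤ - p - p + (B + B)       ≡⟨ regroup B p ⟩
    1ℤ + ((B - p) + (B - p))   ∎)
    where
    open ≡-Reasoning
    A B p : ℤ
    A = ∑[ k < r ] d (toℕ k)
    B = ∑[ k < r ] d (r ℕ.+ toℕ k)
    p = ψ (lab 0)
    halves : ∀ a b → a + b ≡ (a - b) + (b + b)
    halves = solve-∀
    regroup : ∀ b p → 1ℤ - p - p + (b + b) ≡ 1ℤ + ((b - p) + (b - p))
    regroup = solve-∀

  1≤∣deg∣ : 1 ℕ.≤ ∣ deg T n L ∣
  1≤∣deg∣ with deg-odd
  ... | w , deg≡odd = ℕP.n≢0⇒n>0 λ ∣deg∣≡0 → odd≢0 w (trans (sym deg≡odd) (ℤP.∣i∣≡0⇒i≡0 ∣deg∣≡0))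

  selected : List (Tri N)
  selected = filter (nonzero? charge) tris

  ∣deg∣≤selected : ∣ deg T n L ∣ ℕ.≤ length selected
  ∣deg∣≤selected = subst (ℕ._≤ length selected) (trans (cong ∣_∣ total-charge) (ℤP.∣-i∣≡∣i∣ (deg T n L)))
                         (support-bound charge tris charge≤1)
    where
    charge≤1 : ∀ t → t ∈ tris → ∣ charge t ∣ ℕ.≤ 1
    charge≤1 t t∈ with triangle-charged t∈
    ... | inj₁ q≡0         = ℕP.≤-trans (ℕP.≤-reflexive (cong ∣_∣ q≡0)) z≤n
    ... | inj₂ (∣q∣≡1 , _) = ℕP.≤-reflexive ∣q∣≡1

  selected-alternating : ∀ {t} → t ∈ selected → AlternatingTri T n L t
  selected-alternating t∈ with ∈-filter⁻ (nonzero? charge) t∈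
  ... | t∈tris , q≢0 with triangle-charged t∈tris
  ...   | inj₁ q≡0       = ⊥-elim (q≢0 q≡0)
  ...   | inj₂ (_ , alt) = alt

corollary3p5 : ∀ {N : ℕ} (T : SymDiskTriangulation N) (n : ℕ) (L : Fin N → ℤ) →
    IsLabelling T n L →
    AntipodalOnBoundary T n L →
    NeighboringOnBoundary T n L →
    NoComplementaryEdge T n L →
    Σ (List (Tri N)) λ ts →
    Unique ts ×
    All (λ t → t ∈ SymDiskTriangulation.tris T) ts ×
    All (AlternatingTri T n L) ts ×
    ∣ deg T n L ∣ ≤ length ts ×
    1 ≤ length ts
corollary3p5 T n L labelling antipodal neighboring no-compl =
    selected
  , filter⁺ (nonzero? charge) (unique-if-simple tris dc≤1)
  , All.tabulate (λ t∈ → proj₁ (∈-filter⁻ (nonzero? charge) t∈))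
  , All.tabulate selected-alternating
  , ∣deg∣≤selected
  , ℕP.≤-trans 1≤∣deg∣ ∣deg∣≤selected
  where
  open SymDiskTriangulation T using (tris)
  open Boundary T using (dc≤1)
  open Corollary T n L labelling antipodal neighboring no-compl
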